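{- As formal power series in $q$, $$\sum_{n\geq 0} M_n(u_1,u_2,u_3;v_1,v_2)q^{n}=\frac{1-v_1q+(u_3-u_1)q^2-\sqrt{1-2v_1q+(v_1^2-2(u_1+u_3))q^2+2(u_1v_1+u_3v_1-2u_2v_2)q^3+(u_3-u_1)^2q^4}}{2q^2},$$ where the square root is the power series with constant term $1$.
   Context: A plane tree is an unlabeled rooted tree in which the children of every vertex are linearly ordered from left to right. A leaf is a vertex with no children, an interior vertex one with at least one child. A tip-augmented plane tree is a plane tree in which the leftmost child of every interior vertex is a leaf; $\mathcal T_m$ denotes the set of tip-augmented plane trees with $m$ edges. In such a tree: a leaf without siblings is a singleton leaf; a leaf with siblings that is the leftmost child of its parent is an elder twin leaf if the second child of its parent is also a leaf, and an elder non-twin leaf otherwise; a leaf with siblings that is the second child of its parent is a second leaf; a leaf with siblings that is neither the first nor the second child of its parent is a younger leaf. Let $\mathrm{sleaf},\mathrm{etleaf},\mathrm{entleaf},\mathrm{syleaf},\mathrm{yerleaf}$ count these five kinds respectively. For $n\ge1$, $M_n(u_1,u_2,u_3;v_1,v_2)=\sum_{T\in\mathcal T_{n+1}}u_1^{\mathrm{sleaf}(T)}u_2^{\mathrm{etleaf}(T)}u_3^{\mathrm{entleaf}(T)}v_1^{\mathrm{yerleaf}(T)}v_2^{\mathrm{syleaf}(T)}$, and $M_0(u_1,u_2,u_3;v_1,v_2)=u_3$ by convention. -}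

module Defs where

open import Level using (Level)
open import Data.Nat using (ℕ; zero; suc; _∸_)
open import Data.Bool using (Bool; true; false; _∧_)
open import Data.List using (List; []; _∷_; [_]; map; concatMap; upTo; filter; foldr; length)
open import Data.Product using (_×_; _,_)
open import Relation.Nullary using (Dec; yes; no)
open import Relation.Binary.PropositionalEquality using (_≡_; refl)
open import Algebra.Bundles using (CommutativeRing)

data Tree : Set where
  node : List Tree → Tree

isLeaf : Tree → Bool
isLeaf (node []) = true
isLeaf (node (_ ∷ _)) = false

mutual
  edges : Tree → ℕ
  edges (node cs) = edgesF cs

  edgesF : List Tree → ℕ
  edgesF [] = 0
  edgesF (c ∷ cs) = suc (edges c) Data.Nat.+ edgesF cs

-- Enumeration of all plane forests (ordered lists of plane trees) whose
-- total number of edges (each tree contributing its edges plus one edge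
-- to the common parent) is m.  The first argument is fuel (≥ m).
forestsF : ℕ → ℕ → List (List Tree)
forestsF _ zero = [ [] ]
forestsF zero (suc m) = []
forestsF (suc f) (suc m) =
  concatMap (λ k → concatMap (λ t → map (t ∷_) (forestsF f (m ∸ k)))
                             (map node (forestsF f k)))
            (upTo (suc m))

planeTrees : ℕ → List Tree
planeTrees m = map node (forestsF m m)

mutual
  isTipAug : Tree → Bool
  isTipAug (node []) = true
  isTipAug (node (c ∷ cs)) = isLeaf c ∧ isTipAugF (c ∷ cs)

  isTipAugF : List Tree → Bool
  isTipAugF [] = true
  isTipAugF (c ∷ cs) = isTipAug c ∧ isTipAugF cs

isTrue : Bool → Set
isTrue b = b ≡ true

isTrue? : (b : Bool) → Dec (isTrue b)
isTrue? true = yes refl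
isTrue? false = no (λ ())

tipAugTrees : ℕ → List Tree
tipAugTrees m = filter (λ t → isTrue? (isTipAug t)) (planeTrees m)

data Kind : Set where
  sleaf etleaf entleaf syleaf yerleaf : Kind

-- kinds of the leaves among the children list cs of one vertex;
-- the argument i is the (0-based) position of the head of the list.
childKinds : (siblings : ℕ) → (i : ℕ) → List Tree → List Kind
childKinds _ _ [] = []
childKinds 1 _ (c ∷ cs) with isLeaf c
... | true  = sleaf ∷ childKinds 1 1 cs
... | false = childKinds 1 1 cs
childKinds n zero (c ∷ cs) with isLeaf c
... | false = childKinds n 1 cs
... | true with cs
...   | [] = etleaf ∷ []   -- unreachable when n ≥ 2
...   | (d ∷ ds) with isLeaf d
...     | true  = etleaf ∷ childKinds n 1 cs
...     | false = entleaf ∷ childKinds n 1 cs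
childKinds n (suc zero) (c ∷ cs) with isLeaf c
... | true  = syleaf ∷ childKinds n 2 cs
... | false = childKinds n 2 cs
childKinds n (suc (suc i)) (c ∷ cs) with isLeaf c
... | true  = yerleaf ∷ childKinds n (suc (suc (suc i))) cs
... | false = childKinds n (suc (suc (suc i))) cs

_++_ : List Kind → List Kind → List Kind
_++_ = Data.List._++_

-- the list of kinds of all leaves (other than a root without children)
mutual
  leafKinds : Tree → List Kind
  leafKinds (node cs) = childKinds (length cs) 0 cs ++ leafKindsF cs

  leafKindsF : List Tree → List Kind
  leafKindsF [] = []
  leafKindsF (c ∷ cs) = leafKinds c ++ leafKindsF cs

module Series {c ℓ : Level} (R : CommutativeRing c ℓ) where
  open CommutativeRing R

  Seriesₚ : Set c
  Seriesₚ = ℕ → Carrier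

  weight : (u₁ u₂ u₃ v₁ v₂ : Carrier) → Kind → Carrier
  weight u₁ u₂ u₃ v₁ v₂ sleaf = u₁
  weight u₁ u₂ u₃ v₁ v₂ etleaf = u₂
  weight u₁ u₂ u₃ v₁ v₂ entleaf = u₃
  weight u₁ u₂ u₃ v₁ v₂ yerleaf = v₁
  weight u₁ u₂ u₃ v₁ v₂ syleaf = v₂

  monomial : (u₁ u₂ u₃ v₁ v₂ : Carrier) → Tree → Carrier
  monomial u₁ u₂ u₃ v₁ v₂ t =
    foldr (λ k acc → weight u₁ u₂ u₃ v₁ v₂ k * acc) 1# (leafKinds t)

  sumR : List Carrier → Carrier
  sumR = foldr _+_ 0#

  M : (u₁ u₂ u₃ v₁ v₂ : Carrier) → ℕ → Carrier
  M u₁ u₂ u₃ v₁ v₂ zero = u₃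
  M u₁ u₂ u₃ v₁ v₂ (suc n) =
    sumR (map (monomial u₁ u₂ u₃ v₁ v₂) (tipAugTrees (suc (suc n))))

  constₛ : Carrier → Seriesₚ
  constₛ a zero = a
  constₛ a (suc n) = 0#

  mono : Carrier → ℕ → Seriesₚ
  mono a zero = constₛ a
  mono a (suc k) zero = 0#
  mono a (suc k) (suc n) = mono a k n

  shift : ℕ → Seriesₚ → Seriesₚ
  shift zero f = f
  shift (suc k) f zero = 0#
  shift (suc k) f (suc n) = shift k f n

  _+ₛ_ : Seriesₚ → Seriesₚ → Seriesₚ
  (f +ₛ g) n = f n + g n

  _-ₛ_ : Seriesₚ → Seriesₚ → Seriesₚ
  (f -ₛ g) n = f n + - g n

  _*ₛ_ : Seriesₚ → Seriesₚ → Seriesₚ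
  (f *ₛ g) n = sumR (map (λ i → f i * g (n ∸ i)) (upTo (suc n)))

  two : Carrier
  two = 1# + 1#

  Mgf : (u₁ u₂ u₃ v₁ v₂ : Carrier) → Seriesₚ
  Mgf u₁ u₂ u₃ v₁ v₂ = M u₁ u₂ u₃ v₁ v₂

  -- S := 1 - v₁ q + (u₃ - u₁) q² - 2 q² Σ M_n q^n,
  -- so that Σ M_n q^n = (1 - v₁ q + (u₃ - u₁) q² - S) / (2 q²).
  S : (u₁ u₂ u₃ v₁ v₂ : Carrier) → Seriesₚ
  S u₁ u₂ u₃ v₁ v₂ =
    ((mono 1# 0 -ₛ mono v₁ 1) +ₛ mono (u₃ + - u₁) 2)
      -ₛ shift 2 (λ n → two * Mgf u₁ u₂ u₃ v₁ v₂ n)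

  D : (u₁ u₂ u₃ v₁ v₂ : Carrier) → Seriesₚ
  D u₁ u₂ u₃ v₁ v₂ =
    ((((mono 1# 0 -ₛ mono (two * v₁) 1)
      +ₛ mono (v₁ * v₁ + - (two * (u₁ + u₃))) 2)
      +ₛ mono (two * ((u₁ * v₁ + u₃ * v₁) + - (two * (u₂ * v₂)))) 3)
      +ₛ mono ((u₃ + - u₁) * (u₃ + - u₁)) 4)

{-# OPTIONS --safe #-}
-- Cut a tip-augmented tree at its root. The first child is a leaf; if it is the only child the
-- tree weighs u₁, otherwise the second child is a leaf (u₂ v₂ for the elder twin and the second
-- leaf) or a subtree (u₃ for the elder non-twin leaf, times the subtree), and every later child
-- is a leaf (v₁) or a subtree. With T the series of trees counted by q^(edges − 1) and Y that of
-- the lists of later children,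
--   T = u₁ + q H Y,   H = u₂ v₂ + q u₃ T,   Y = 1 + q (v₁ + q T) Y,   Σ Mₙ qⁿ = u₃ + q H Y.
-- Substituting these into S, the ring solver (power series over R form a commutative ring)
-- gives S² = D − 4 q³ (H Y (1 − q (v₁ + q T)) − H), and the bracket vanishes because
-- Y (1 − q (v₁ + q T)) = 1.
module Submission where

open import Algebra.Bundles using (CommutativeRing)
open import Data.Bool.Base using (Bool; true; false; _∧_)
open import Data.Integer.Base as ℤ using (ℤ; +_; -[1+_]; _⊖_; sign; ∣_∣; _◃_)
import Data.Integer.Properties as ℤ
open import Data.List.Base as List
  using (List; []; _∷_; map; foldr; length; upTo; concat; concatMap; filter)
import Data.List.Properties as List
open import Data.List.Relation.Unary.All as All using (All)
open import Data.List.Relation.Unary.All.Properties using (all-upTo)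
open import Data.Maybe.Base using (Maybe; just; nothing)
open import Data.Nat.Base as ℕ using (ℕ; zero; suc; _∸_; _≤_; _<_; s≤s)
import Data.Nat.Properties as ℕ
open import Data.Product.Base using (_×_; _,_)
open import Data.Sign.Base as Sign using (Sign)
open import Function.Base using (_∘_)
open import Level using (Level)
open import Relation.Binary.PropositionalEquality.Core as ≡ using (_≡_)
open import Relation.Nullary.Decidable.Core using (yes; no)

open import Defs

module IntegerCoefficientRingSolver {c ℓ} (R : CommutativeRing c ℓ) where
  open CommutativeRing R
  open import Algebra.Properties.Ring ring
    using (-0#≈0#; -‿involutive; -‿distribˡ-*; -‿distribʳ-*)
  open import Algebra.Properties.AbelianGroup +-abelianGroup using (⁻¹-∙-comm)
  open import Algebra.Properties.CommutativeSemigroup +-commutativeSemigroup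
    using (interchange)
  -- With this variant of n × 1# the coefficient 2 evaluates to 1# + 1#, so solver
  -- equations using `con (+ 2)` match `Series.two` literally.
  open import Algebra.Properties.Semiring.Mult.TCOptimised semiring
    using (1+×; ×-homo-+; ×1-homo-*) renaming (_×_ to _×′_)
  open import Algebra.Solver.Ring.AlmostCommutativeRing
    using (fromCommutativeRing; _-Raw-AlmostCommutative⟶_)
  open import Relation.Binary.Reasoning.Setoid setoid

  private
    signed : Sign → Carrier → Carrier
    signed Sign.+ x = x
    signed Sign.- x = - x

    ⟦_⟧ℤ : ℤ → Carrier
    ⟦ i ⟧ℤ = signed (sign i) (∣ i ∣ ×′ 1#)

    1+x-[1+y]≈x-y : ∀ x y → (1# + x) - (1# + y) ≈ x - y
    1+x-[1+y]≈x-y x y = begin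
      (1# + x) - (1# + y)     ≈⟨ +-congˡ (⁻¹-∙-comm 1# y) ⟨
      (1# + x) + (- 1# - y)   ≈⟨ interchange 1# x (- 1#) (- y) ⟩
      (1# - 1#) + (x - y)     ≈⟨ +-congʳ (-‿inverseʳ 1#) ⟩
      0# + (x - y)            ≈⟨ +-identityˡ (x - y) ⟩
      x - y                   ∎

    ⊖-homo : ∀ m n → ⟦ m ⊖ n ⟧ℤ ≈ m ×′ 1# - n ×′ 1#
    ⊖-homo m       zero    = sym (trans (+-congˡ -0#≈0#) (+-identityʳ _))
    ⊖-homo zero    (suc n) = sym (+-identityˡ _)
    ⊖-homo (suc m) (suc n) = begin
      ⟦ suc m ⊖ suc n ⟧ℤ              ≡⟨ ≡.cong ⟦_⟧ℤ (ℤ.[1+m]⊖[1+n]≡m⊖n m n) ⟩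
      ⟦ m ⊖ n ⟧ℤ                      ≈⟨ ⊖-homo m n ⟩
      m ×′ 1# - n ×′ 1#               ≈⟨ 1+x-[1+y]≈x-y (m ×′ 1#) (n ×′ 1#) ⟨
      (1# + m ×′ 1#) - (1# + n ×′ 1#) ≈⟨ +-cong (1+× m 1#) (-‿cong (1+× n 1#)) ⟨
      suc m ×′ 1# - suc n ×′ 1#       ∎

    +-homo : ∀ i j → ⟦ i ℤ.+ j ⟧ℤ ≈ ⟦ i ⟧ℤ + ⟦ j ⟧ℤ
    +-homo (+ m)    (+ n)    = ×-homo-+ 1# m n
    +-homo (+ m)    -[1+ n ] = ⊖-homo m (suc n)
    +-homo -[1+ m ] (+ n)    = trans (⊖-homo n (suc m)) (+-comm _ _)
    +-homo -[1+ m ] -[1+ n ] = begin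
      - (suc (suc m ℕ.+ n) ×′ 1#)     ≡⟨ ≡.cong (λ k → - (k ×′ 1#)) (ℕ.+-suc (suc m) n) ⟨
      - ((suc m ℕ.+ suc n) ×′ 1#)     ≈⟨ -‿cong (×-homo-+ 1# (suc m) (suc n)) ⟩
      - (suc m ×′ 1# + suc n ×′ 1#)   ≈⟨ ⁻¹-∙-comm _ _ ⟨
      - (suc m ×′ 1#) - suc n ×′ 1#   ∎

    signed-cong : ∀ s {x y} → x ≈ y → signed s x ≈ signed s y
    signed-cong Sign.+ x≈y = x≈y
    signed-cong Sign.- x≈y = -‿cong x≈y

    signed-* : ∀ s t x y → signed (s Sign.* t) (x * y) ≈ signed s x * signed t y
    signed-* Sign.+ Sign.+ x y = refl
    signed-* Sign.+ Sign.- x y = -‿distribʳ-* x y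
    signed-* Sign.- Sign.+ x y = -‿distribˡ-* x y
    signed-* Sign.- Sign.- x y = begin
      x * y         ≈⟨ -‿involutive (x * y) ⟨
      - - (x * y)   ≈⟨ -‿cong (-‿distribˡ-* x y) ⟩
      - (- x * y)   ≈⟨ -‿distribʳ-* (- x) y ⟩
      - x * - y     ∎

    ◃-homo : ∀ s n → ⟦ s ◃ n ⟧ℤ ≈ signed s (n ×′ 1#)
    ◃-homo Sign.+ zero    = refl
    ◃-homo Sign.- zero    = sym -0#≈0#
    ◃-homo Sign.+ (suc n) = refl
    ◃-homo Sign.- (suc n) = refl

    *-homo : ∀ i j → ⟦ i ℤ.* j ⟧ℤ ≈ ⟦ i ⟧ℤ * ⟦ j ⟧ℤ
    *-homo i j = begin
      ⟦ sign i Sign.* sign j ◃ ∣ i ∣ ℕ.* ∣ j ∣ ⟧ℤ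
        ≈⟨ ◃-homo (sign i Sign.* sign j) (∣ i ∣ ℕ.* ∣ j ∣) ⟩
      signed (sign i Sign.* sign j) ((∣ i ∣ ℕ.* ∣ j ∣) ×′ 1#)
        ≈⟨ signed-cong (sign i Sign.* sign j) (×1-homo-* ∣ i ∣ ∣ j ∣) ⟩
      signed (sign i Sign.* sign j) (∣ i ∣ ×′ 1# * ∣ j ∣ ×′ 1#)
        ≈⟨ signed-* (sign i) (sign j) _ _ ⟩
      ⟦ i ⟧ℤ * ⟦ j ⟧ℤ ∎

    -‿homo : ∀ i → ⟦ ℤ.- i ⟧ℤ ≈ - ⟦ i ⟧ℤ
    -‿homo (+ zero)  = sym -0#≈0#
    -‿homo (+ suc n) = refl
    -‿homo -[1+ n ]  = sym (-‿involutive _)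

    ℤ⟶R : ℤ.+-*-rawRing -Raw-AlmostCommutative⟶ fromCommutativeRing R
    ℤ⟶R = record
      { ⟦_⟧ = ⟦_⟧ℤ ; +-homo = +-homo ; *-homo = *-homo ; -‿homo = -‿homo
      ; 0-homo = refl ; 1-homo = refl }

    ⟦⟧ℤ-equal? : ∀ i j → Maybe (⟦ i ⟧ℤ ≈ ⟦ j ⟧ℤ)
    ⟦⟧ℤ-equal? i j with i ℤ.≟ j
    ... | yes ≡.refl = just refl
    ... | no _       = nothing

  open import Algebra.Solver.Ring ℤ.+-*-rawRing (fromCommutativeRing R) ℤ⟶R ⟦⟧ℤ-equal? public

module FormalPowerSeries {c ℓ} (R : CommutativeRing c ℓ) where
  open CommutativeRing R hiding (zero)
  open Series R
  open import Algebra.Properties.Ring ring using (-0#≈0#)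
  open import Relation.Binary.Reasoning.Setoid setoid
  open IntegerCoefficientRingSolver R using (solve; _:=_; _:+_; _:*_)

  infix 4 _≋_
  _≋_ : Seriesₚ → Seriesₚ → Set ℓ
  f ≋ g = ∀ n → f n ≈ g n

  tailₛ : Seriesₚ → Seriesₚ
  tailₛ f n = f (suc n)

  -ₛ_ : Seriesₚ → Seriesₚ
  (-ₛ f) n = - f n

  0ₛ 1ₛ : Seriesₚ
  0ₛ = constₛ 0#
  1ₛ = constₛ 1#

  constₛ-0# : ∀ n → 0ₛ n ≈ 0#
  constₛ-0# zero    = refl
  constₛ-0# (suc n) = refl

  sum-upTo-suc : ∀ (h : ℕ → Carrier) n →
    sumR (map h (upTo (suc n))) ≡ h 0 + sumR (map (h ∘ suc) (upTo n))
  sum-upTo-suc h n = ≡.cong (λ hs → h 0 + sumR hs)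
    (≡.trans (List.map-applyUpTo suc h n) (≡.sym (List.map-upTo (h ∘ suc) n)))

  *ₛ-zero : ∀ f g → (f *ₛ g) 0 ≈ f 0 * g 0
  *ₛ-zero f g = +-identityʳ (f 0 * g 0)

  *ₛ-suc : ∀ f g n → (f *ₛ g) (suc n) ≈ f 0 * g (suc n) + (tailₛ f *ₛ g) n
  *ₛ-suc f g n = reflexive (sum-upTo-suc (λ i → f i * g (suc n ∸ i)) (suc n))

  *ₛ-sucʳ : ∀ f g n → (f *ₛ g) (suc n) ≈ (f *ₛ tailₛ g) n + f (suc n) * g 0
  *ₛ-sucʳ f g zero = begin
    (f *ₛ g) 1
      ≈⟨ *ₛ-suc f g 0 ⟩
    f 0 * g 1 + (tailₛ f *ₛ g) 0
      ≈⟨ +-cong (sym (*ₛ-zero f (tailₛ g))) (*ₛ-zero (tailₛ f) g) ⟩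
    (f *ₛ tailₛ g) 0 + f 1 * g 0
      ∎
  *ₛ-sucʳ f g (suc n) = begin
    (f *ₛ g) (suc (suc n))
      ≈⟨ *ₛ-suc f g (suc n) ⟩
    f 0 * g (suc (suc n)) + (tailₛ f *ₛ g) (suc n)
      ≈⟨ +-congˡ (*ₛ-sucʳ (tailₛ f) g n) ⟩
    f 0 * g (suc (suc n)) + ((tailₛ f *ₛ tailₛ g) n + f (suc (suc n)) * g 0)
      ≈⟨ +-assoc _ _ _ ⟨
    (f 0 * g (suc (suc n)) + (tailₛ f *ₛ tailₛ g) n) + f (suc (suc n)) * g 0
      ≈⟨ +-congʳ (*ₛ-suc f (tailₛ g) n) ⟨
    (f *ₛ tailₛ g) (suc n) + f (suc (suc n)) * g 0
      ∎

  *ₛ-cong : ∀ {f f′ g g′} → f ≋ f′ → g ≋ g′ → f *ₛ g ≋ f′ *ₛ g′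
  *ₛ-cong f≋f′ g≋g′ zero    = +-congʳ (*-cong (f≋f′ 0) (g≋g′ 0))
  *ₛ-cong {f} {f′} {g} {g′} f≋f′ g≋g′ (suc n) = begin
    (f *ₛ g) (suc n)                       ≈⟨ *ₛ-suc f g n ⟩
    f 0 * g (suc n) + (tailₛ f *ₛ g) n     ≈⟨ +-cong (*-cong (f≋f′ 0) (g≋g′ (suc n)))
                                                     (*ₛ-cong (f≋f′ ∘ suc) g≋g′ n) ⟩
    f′ 0 * g′ (suc n) + (tailₛ f′ *ₛ g′) n ≈⟨ *ₛ-suc f′ g′ n ⟨
    (f′ *ₛ g′) (suc n)                     ∎

  *ₛ-scaleˡ : ∀ a f g → (λ i → a * f i) *ₛ g ≋ λ n → a * (f *ₛ g) n
  *ₛ-scaleˡ a f g zero = begin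
    (a * f 0) * g 0 + 0#  ≈⟨ +-identityʳ _ ⟩
    (a * f 0) * g 0       ≈⟨ *-assoc a (f 0) (g 0) ⟩
    a * (f 0 * g 0)       ≈⟨ *-congˡ (*ₛ-zero f g) ⟨
    a * (f *ₛ g) 0        ∎
  *ₛ-scaleˡ a f g (suc n) = begin
    ((λ i → a * f i) *ₛ g) (suc n)
      ≈⟨ *ₛ-suc (λ i → a * f i) g n ⟩
    (a * f 0) * g (suc n) + ((λ i → a * f (suc i)) *ₛ g) n
      ≈⟨ +-cong (*-assoc a (f 0) (g (suc n))) (*ₛ-scaleˡ a (tailₛ f) g n) ⟩
    a * (f 0 * g (suc n)) + a * (tailₛ f *ₛ g) n
      ≈⟨ distribˡ a _ _ ⟨
    a * (f 0 * g (suc n) + (tailₛ f *ₛ g) n)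
      ≈⟨ *-congˡ (*ₛ-suc f g n) ⟨
    a * (f *ₛ g) (suc n)
      ∎

  *ₛ-constˡ : ∀ a g → constₛ a *ₛ g ≋ λ n → a * g n
  *ₛ-constˡ a g zero    = *ₛ-zero (constₛ a) g
  *ₛ-constˡ a g (suc n) = begin
    (constₛ a *ₛ g) (suc n)
      ≈⟨ *ₛ-suc (constₛ a) g n ⟩
    a * g (suc n) + (tailₛ (constₛ a) *ₛ g) n
      ≈⟨ +-congˡ (*ₛ-cong {g = g} {g′ = g} (λ _ → sym (zeroˡ 0#)) (λ _ → refl) n) ⟩
    a * g (suc n) + ((λ _ → 0# * 0#) *ₛ g) n
      ≈⟨ +-congˡ (*ₛ-scaleˡ 0# (λ _ → 0#) g n) ⟩
    a * g (suc n) + 0# * ((λ _ → 0#) *ₛ g) n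
      ≈⟨ +-congˡ (zeroˡ _) ⟩
    a * g (suc n) + 0#
      ≈⟨ +-identityʳ _ ⟩
    a * g (suc n)
      ∎

  *ₛ-distribʳ : ∀ h f g → (f +ₛ g) *ₛ h ≋ (f *ₛ h) +ₛ (g *ₛ h)
  *ₛ-distribʳ h f g zero = begin
    ((f +ₛ g) *ₛ h) 0           ≈⟨ *ₛ-zero (f +ₛ g) h ⟩
    (f 0 + g 0) * h 0           ≈⟨ distribʳ (h 0) (f 0) (g 0) ⟩
    f 0 * h 0 + g 0 * h 0       ≈⟨ +-cong (*ₛ-zero f h) (*ₛ-zero g h) ⟨
    (f *ₛ h) 0 + (g *ₛ h) 0     ∎
  *ₛ-distribʳ h f g (suc n) = begin
    ((f +ₛ g) *ₛ h) (suc n)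
      ≈⟨ *ₛ-suc (f +ₛ g) h n ⟩
    (f 0 + g 0) * h (suc n) + ((tailₛ f +ₛ tailₛ g) *ₛ h) n
      ≈⟨ +-cong (distribʳ _ _ _) (*ₛ-distribʳ h (tailₛ f) (tailₛ g) n) ⟩
    (f 0 * h (suc n) + g 0 * h (suc n)) + ((tailₛ f *ₛ h) n + (tailₛ g *ₛ h) n)
      ≈⟨ solve 4 (λ a b x y → (a :+ b) :+ (x :+ y) := (a :+ x) :+ (b :+ y)) refl _ _ _ _ ⟩
    (f 0 * h (suc n) + (tailₛ f *ₛ h) n) + (g 0 * h (suc n) + (tailₛ g *ₛ h) n)
      ≈⟨ +-cong (*ₛ-suc f h n) (*ₛ-suc g h n) ⟨
    (f *ₛ h) (suc n) + (g *ₛ h) (suc n)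
      ∎

  *ₛ-comm : ∀ f g → f *ₛ g ≋ g *ₛ f
  *ₛ-comm f g zero = begin
    (f *ₛ g) 0   ≈⟨ *ₛ-zero f g ⟩
    f 0 * g 0    ≈⟨ *-comm (f 0) (g 0) ⟩
    g 0 * f 0    ≈⟨ *ₛ-zero g f ⟨
    (g *ₛ f) 0   ∎
  *ₛ-comm f g (suc n) = begin
    (f *ₛ g) (suc n)                    ≈⟨ *ₛ-suc f g n ⟩
    f 0 * g (suc n) + (tailₛ f *ₛ g) n  ≈⟨ +-cong (*-comm _ _) (*ₛ-comm (tailₛ f) g n) ⟩
    g (suc n) * f 0 + (g *ₛ tailₛ f) n  ≈⟨ +-comm _ _ ⟩
    (g *ₛ tailₛ f) n + g (suc n) * f 0  ≈⟨ *ₛ-sucʳ g f n ⟨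
    (g *ₛ f) (suc n)                    ∎

  *ₛ-assoc : ∀ f g h → (f *ₛ g) *ₛ h ≋ f *ₛ (g *ₛ h)
  *ₛ-assoc f g h zero = begin
    ((f *ₛ g) *ₛ h) 0    ≈⟨ *ₛ-zero (f *ₛ g) h ⟩
    (f *ₛ g) 0 * h 0     ≈⟨ *-congʳ (*ₛ-zero f g) ⟩
    (f 0 * g 0) * h 0    ≈⟨ *-assoc _ _ _ ⟩
    f 0 * (g 0 * h 0)    ≈⟨ *-congˡ (*ₛ-zero g h) ⟨
    f 0 * (g *ₛ h) 0     ≈⟨ *ₛ-zero f (g *ₛ h) ⟨
    (f *ₛ (g *ₛ h)) 0    ∎
  *ₛ-assoc f g h (suc n) = begin
    ((f *ₛ g) *ₛ h) (suc n)
      ≈⟨ *ₛ-suc (f *ₛ g) h n ⟩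
    (f *ₛ g) 0 * h (suc n) + (tailₛ (f *ₛ g) *ₛ h) n
      ≈⟨ +-cong (*-congʳ (*ₛ-zero f g))
                (*ₛ-cong {g = h} {g′ = h} (*ₛ-suc f g) (λ _ → refl) n) ⟩
    (f 0 * g 0) * h (suc n) + (((λ i → f 0 * g (suc i)) +ₛ (tailₛ f *ₛ g)) *ₛ h) n
      ≈⟨ +-congˡ (*ₛ-distribʳ h (λ i → f 0 * g (suc i)) (tailₛ f *ₛ g) n) ⟩
    (f 0 * g 0) * h (suc n) + (((λ i → f 0 * g (suc i)) *ₛ h) n + ((tailₛ f *ₛ g) *ₛ h) n)
      ≈⟨ +-congˡ (+-cong (*ₛ-scaleˡ (f 0) (tailₛ g) h n) (*ₛ-assoc (tailₛ f) g h n)) ⟩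
    (f 0 * g 0) * h (suc n) + (f 0 * (tailₛ g *ₛ h) n + (tailₛ f *ₛ (g *ₛ h)) n)
      ≈⟨ solve 5 (λ a b x y z → a :* b :* x :+ (a :* y :+ z) := a :* (b :* x :+ y) :+ z)
               refl _ _ _ _ _ ⟩
    f 0 * (g 0 * h (suc n) + (tailₛ g *ₛ h) n) + (tailₛ f *ₛ (g *ₛ h)) n
      ≈⟨ +-congʳ (*-congˡ (*ₛ-suc g h n)) ⟨
    f 0 * (g *ₛ h) (suc n) + (tailₛ f *ₛ (g *ₛ h)) n
      ≈⟨ *ₛ-suc f (g *ₛ h) n ⟨
    ((f *ₛ (g *ₛ h)) (suc n))
      ∎

  *ₛ-identityˡ : ∀ g → 1ₛ *ₛ g ≋ g
  *ₛ-identityˡ g n = trans (*ₛ-constˡ 1# g n) (*-identityˡ (g n))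

  powerSeriesRing : CommutativeRing c ℓ
  powerSeriesRing = record
    { Carrier = Seriesₚ ; _≈_ = _≋_ ; _+_ = _+ₛ_ ; _*_ = _*ₛ_ ; -_ = -ₛ_ ; 0# = 0ₛ ; 1# = 1ₛ
    ; isCommutativeRing = record
      { isRing = record
        { +-isAbelianGroup = record
          { isGroup = record
            { isMonoid = record
              { isSemigroup = record
                { isMagma = record
                  { isEquivalence = record
                    { refl  = λ _ → refl
                    ; sym   = λ p n → sym (p n)
                    ; trans = λ p q n → trans (p n) (q n) }
                  ; ∙-cong = λ p q n → +-cong (p n) (q n) }
                ; assoc = λ f g h n → +-assoc (f n) (g n) (h n) }
              ; identity = (λ f n → trans (+-congʳ (constₛ-0# n)) (+-identityˡ (f n)))
                         , (λ f n → trans (+-congˡ (constₛ-0# n)) (+-identityʳ (f n))) }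
            ; inverse = (λ f n → trans (-‿inverseˡ (f n)) (sym (constₛ-0# n)))
                      , (λ f n → trans (-‿inverseʳ (f n)) (sym (constₛ-0# n)))
            ; ⁻¹-cong = λ p n → -‿cong (p n) }
          ; comm = λ f g n → +-comm (f n) (g n) }
        ; *-cong = *ₛ-cong
        ; *-assoc = *ₛ-assoc
        ; *-identity = *ₛ-identityˡ , (λ g n → trans (*ₛ-comm g 1ₛ n) (*ₛ-identityˡ g n))
        ; distrib = (λ h f g n → trans (*ₛ-comm h (f +ₛ g) n) (trans (*ₛ-distribʳ h f g n)
                                    (+-cong (*ₛ-comm f h n) (*ₛ-comm g h n))))
                  , *ₛ-distribʳ }
      ; *-comm = *ₛ-comm } }

  X : Seriesₚ
  X = mono 1# 1

  X*ₛ-zero : ∀ g → (X *ₛ g) 0 ≈ 0#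
  X*ₛ-zero g = trans (*ₛ-zero X g) (zeroˡ (g 0))

  X*ₛ-suc : ∀ g n → (X *ₛ g) (suc n) ≈ g n
  X*ₛ-suc g n = begin
    (X *ₛ g) (suc n)                 ≈⟨ *ₛ-suc X g n ⟩
    0# * g (suc n) + (1ₛ *ₛ g) n     ≈⟨ +-cong (zeroˡ _) (*ₛ-identityˡ g n) ⟩
    0# + g n                         ≈⟨ +-identityˡ (g n) ⟩
    g n                              ∎

  ≋-const+X*ₛ : ∀ {f a g} → f 0 ≈ a → tailₛ f ≋ g → f ≋ constₛ a +ₛ (X *ₛ g)
  ≋-const+X*ₛ {g = g} f₀≈a _ zero =
    trans f₀≈a (sym (trans (+-congˡ (X*ₛ-zero g)) (+-identityʳ _)))
  ≋-const+X*ₛ {g = g} _ tail≋g (suc n) =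
    trans (tail≋g n) (sym (trans (+-identityˡ _) (X*ₛ-suc g n)))

  infixr 7 X^_*ₛ_
  X^_*ₛ_ : ℕ → Seriesₚ → Seriesₚ
  X^ zero  *ₛ g = g
  X^ suc k *ₛ g = X *ₛ (X^ k *ₛ g)

  shift-≋ : ∀ k {f g} → f ≋ g → shift k f ≋ X^ k *ₛ g
  shift-≋ zero    f≋g = f≋g
  shift-≋ (suc k) {f} {g} f≋g zero    = sym (X*ₛ-zero (X^ k *ₛ g))
  shift-≋ (suc k) {f} {g} f≋g (suc n) = trans (shift-≋ k f≋g n) (sym (X*ₛ-suc (X^ k *ₛ g) n))

  mono-≋ : ∀ k {a g} → constₛ a ≋ g → mono a k ≋ X^ k *ₛ g
  mono-≋ zero    a≋g = a≋g
  mono-≋ (suc k) {g = g} a≋g zero    = sym (X*ₛ-zero (X^ k *ₛ g))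
  mono-≋ (suc k) {g = g} a≋g (suc n) = trans (mono-≋ k a≋g n) (sym (X*ₛ-suc (X^ k *ₛ g) n))

  constₛ-+ : ∀ a b → constₛ (a + b) ≋ constₛ a +ₛ constₛ b
  constₛ-+ a b zero    = refl
  constₛ-+ a b (suc n) = sym (+-identityʳ 0#)

  constₛ-* : ∀ a b → constₛ (a * b) ≋ constₛ a *ₛ constₛ b
  constₛ-* a b zero    = sym (*ₛ-zero (constₛ a) (constₛ b))
  constₛ-* a b (suc n) = sym (trans (*ₛ-constˡ a (constₛ b) (suc n)) (zeroʳ a))

  constₛ-‿ : ∀ a → constₛ (- a) ≋ -ₛ constₛ a
  constₛ-‿ a zero    = refl
  constₛ-‿ a (suc n) = sym -0#≈0#

module ListSums {c ℓ} (R : CommutativeRing c ℓ) where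
  open CommutativeRing R
  open Series R using (sumR)

  private
    variable
      A B : Set

  sumMap : (A → Carrier) → List A → Carrier
  sumMap g xs = sumR (map g xs)

  sumMap-cong : ∀ {g h : A → Carrier} → (∀ x → g x ≈ h x) → ∀ xs → sumMap g xs ≈ sumMap h xs
  sumMap-cong g≈h []       = refl
  sumMap-cong g≈h (x ∷ xs) = +-cong (g≈h x) (sumMap-cong g≈h xs)

  sumMap-zero : ∀ {g : A → Carrier} → (∀ x → g x ≈ 0#) → ∀ xs → sumMap g xs ≈ 0#
  sumMap-zero g≈0 []       = refl
  sumMap-zero g≈0 (x ∷ xs) = trans (+-cong (g≈0 x) (sumMap-zero g≈0 xs)) (+-identityʳ 0#)

  sumMap-++ : ∀ (g : A → Carrier) xs ys →
    sumMap g (xs List.++ ys) ≈ sumMap g xs + sumMap g ys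
  sumMap-++ g []       ys = sym (+-identityˡ _)
  sumMap-++ g (x ∷ xs) ys = trans (+-congˡ (sumMap-++ g xs ys)) (sym (+-assoc _ _ _))

  sumMap-concatMap : ∀ (g : B → Carrier) (h : A → List B) xs →
    sumMap g (concatMap h xs) ≈ sumMap (sumMap g ∘ h) xs
  sumMap-concatMap g h []       = refl
  sumMap-concatMap g h (x ∷ xs) =
    trans (sumMap-++ g (h x) (concatMap h xs)) (+-congˡ (sumMap-concatMap g h xs))

  sumMap-map : ∀ (g : B → Carrier) (f : A → B) xs →
    sumMap g (map f xs) ≡ sumMap (g ∘ f) xs
  sumMap-map g f xs = ≡.cong sumR (≡.sym (List.map-∘ xs))

  sumMap-*ˡ : ∀ a (g : A → Carrier) xs → sumMap (λ x → a * g x) xs ≈ a * sumMap g xs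
  sumMap-*ˡ a g []       = sym (zeroʳ a)
  sumMap-*ˡ a g (x ∷ xs) = trans (+-congˡ (sumMap-*ˡ a g xs)) (sym (distribˡ _ _ _))

  sumMap-*ʳ : ∀ a (g : A → Carrier) xs → sumMap (λ x → g x * a) xs ≈ sumMap g xs * a
  sumMap-*ʳ a g []       = sym (zeroˡ a)
  sumMap-*ʳ a g (x ∷ xs) = trans (+-congˡ (sumMap-*ʳ a g xs)) (sym (distribʳ _ _ _))

  indicator : Bool → Carrier
  indicator true  = 1#
  indicator false = 0#

  sumMap-filter : ∀ (p : A → Bool) (g : A → Carrier) xs →
    sumMap g (filter (λ x → isTrue? (p x)) xs) ≈ sumMap (λ x → indicator (p x) * g x) xs
  sumMap-filter p g []       = refl
  sumMap-filter p g (x ∷ xs) with p x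
  ... | true  = +-cong (sym (*-identityˡ (g x))) (sumMap-filter p g xs)
  ... | false = trans (sumMap-filter p g xs) (sym (trans (+-congʳ (zeroˡ (g x))) (+-identityˡ _)))

forestsWithHeadF : (fuel m k : ℕ) → List (List Tree)
forestsWithHeadF f m k =
  concatMap (λ t → map (t ∷_) (forestsF f (m ∸ k))) (map node (forestsF f k))

forestsF-fuel : ∀ {f g m} → m ≤ f → m ≤ g → forestsF f m ≡ forestsF g m
forestsF-fuel {m = zero} _ _ = ≡.refl
forestsF-fuel {suc f} {suc g} {suc m} (s≤s m≤f) (s≤s m≤g) =
  ≡.cong concat (List.map-cong-local (All.map same-heads (all-upTo (suc m))))
  where
  same-heads : ∀ {k} → k < suc m → forestsWithHeadF f m k ≡ forestsWithHeadF g m k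
  same-heads {k} (s≤s k≤m) = ≡.cong₂ (λ as rs → concatMap (λ t → map (t ∷_) rs) (map node as))
    (forestsF-fuel (ℕ.≤-trans k≤m m≤f) (ℕ.≤-trans k≤m m≤g))
    (forestsF-fuel (ℕ.≤-trans (ℕ.m∸n≤m m k) m≤f) (ℕ.≤-trans (ℕ.m∸n≤m m k) m≤g))

forests : ℕ → List (List Tree)
forests m = forestsF m m

forestsWithHead : (m k : ℕ) → List (List Tree)
forestsWithHead m k = concatMap (λ a → map (node a ∷_) (forests (m ∸ k))) (forests k)

forests-suc : ∀ m → forests (suc m) ≡ concatMap (forestsWithHead m) (upTo (suc m))
forests-suc m = ≡.cong concat (List.map-cong-local (All.map enough-fuel (all-upTo (suc m))))
  where
  enough-fuel : ∀ {k} → k < suc m → forestsWithHeadF m m k ≡ forestsWithHead m k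
  enough-fuel {k} (s≤s k≤m) = ≡.trans
    (≡.cong₂ (λ as rs → concatMap (λ t → map (t ∷_) rs) (map node as))
      (forestsF-fuel k≤m ℕ.≤-refl) (forestsF-fuel (ℕ.m∸n≤m m k) ℕ.≤-refl))
    (List.concatMap-map _ node (forests k))

module ForestSums {c ℓ} (R : CommutativeRing c ℓ) where
  open CommutativeRing R
  open Series R
  open ListSums R
  open FormalPowerSeries R using (_≋_; tailₛ)
  open import Relation.Binary.Reasoning.Setoid setoid

  forestSum : (List Tree → Carrier) → Seriesₚ
  forestSum g m = sumMap g (forests m)

  forestSum-zero : ∀ (g : List Tree → Carrier) → forestSum g 0 ≈ g []
  forestSum-zero g = +-identityʳ (g [])

  headSplitSum : (List Tree → Carrier) → (m k : ℕ) → Carrier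
  headSplitSum g m k = forestSum (λ a → forestSum (λ r → g (node a ∷ r)) (m ∸ k)) k

  forestSum-suc : ∀ g m → forestSum g (suc m) ≈ sumMap (headSplitSum g m) (upTo (suc m))
  forestSum-suc g m = begin
    sumMap g (forests (suc m))
      ≡⟨ ≡.cong (sumMap g) (forests-suc m) ⟩
    sumMap g (concatMap (forestsWithHead m) (upTo (suc m)))
      ≈⟨ sumMap-concatMap g (forestsWithHead m) (upTo (suc m)) ⟩
    sumMap (sumMap g ∘ forestsWithHead m) (upTo (suc m))
      ≈⟨ sumMap-cong split (upTo (suc m)) ⟩
    sumMap (headSplitSum g m) (upTo (suc m)) ∎
    where
    split : ∀ k → sumMap g (forestsWithHead m k) ≈ headSplitSum g m k
    split k = trans (sumMap-concatMap g _ (forests k))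
      (sumMap-cong (λ a → reflexive (sumMap-map g (node a ∷_) (forests (m ∸ k)))) (forests k))

  forestSum-tail-* : ∀ {g} (h k : List Tree → Carrier) →
    (∀ a r → g (node a ∷ r) ≈ h a * k r) →
    tailₛ (forestSum g) ≋ forestSum h *ₛ forestSum k
  forestSum-tail-* {g} h k g≈h*k m = trans (forestSum-suc g m) (sumMap-cong factor (upTo (suc m)))
    where
    factor : ∀ i → headSplitSum g m i ≈ forestSum h i * forestSum k (m ∸ i)
    factor i = begin
      headSplitSum g m i
        ≈⟨ sumMap-cong (λ a → trans (sumMap-cong (g≈h*k a) (forests (m ∸ i)))
                                    (sumMap-*ˡ (h a) k (forests (m ∸ i)))) (forests i) ⟩
      sumMap (λ a → h a * forestSum k (m ∸ i)) (forests i)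
        ≈⟨ sumMap-*ʳ (forestSum k (m ∸ i)) h (forests i) ⟩
      forestSum h i * forestSum k (m ∸ i) ∎

  forestSum-tail-cong : ∀ {g g′ : List Tree → Carrier} →
    (∀ t ts → g (t ∷ ts) ≈ g′ (t ∷ ts)) →
    tailₛ (forestSum g) ≋ tailₛ (forestSum g′)
  forestSum-tail-cong {g} {g′} g≈g′ m = begin
    forestSum g (suc m)                          ≈⟨ forestSum-suc g m ⟩
    sumMap (headSplitSum g m) (upTo (suc m))     ≈⟨ sumMap-cong same-split (upTo (suc m)) ⟩
    sumMap (headSplitSum g′ m) (upTo (suc m))    ≈⟨ forestSum-suc g′ m ⟨
    forestSum g′ (suc m)                         ∎
    where
    same-split : ∀ k → headSplitSum g m k ≈ headSplitSum g′ m k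
    same-split k = sumMap-cong (λ a → sumMap-cong (g≈g′ (node a)) (forests (m ∸ k))) (forests k)

module LeafWeights {c ℓ} (R : CommutativeRing c ℓ)
  (u₁ u₂ u₃ v₁ v₂ : CommutativeRing.Carrier R) where
  open CommutativeRing R
  open Series R using (weight; monomial)
  open ListSums R using (indicator)
  open IntegerCoefficientRingSolver R using (solve; _:=_; _:*_)
  open import Relation.Binary.Reasoning.Setoid setoid

  kindProduct : List Kind → Carrier
  kindProduct = foldr (λ k w → weight u₁ u₂ u₃ v₁ v₂ k * w) 1#

  kindProduct-++ : ∀ ks ls → kindProduct (ks ++ ls) ≈ kindProduct ks * kindProduct ls
  kindProduct-++ []       ls = sym (*-identityˡ _)
  kindProduct-++ (k ∷ ks) ls = trans (*-congˡ (kindProduct-++ ks ls)) (sym (*-assoc _ _ _))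

  indicator-∧ : ∀ a b → indicator (a ∧ b) ≈ indicator a * indicator b
  indicator-∧ true  b = sym (*-identityˡ _)
  indicator-∧ false b = sym (zeroˡ _)

  treeWeight : List Tree → Carrier
  treeWeight cs = indicator (isTipAug (node cs)) * monomial u₁ u₂ u₃ v₁ v₂ (node cs)

  youngerWeight : Tree → Carrier
  youngerWeight (node [])       = v₁
  youngerWeight (node (c ∷ cs)) = treeWeight (c ∷ cs)

  youngerWeights : List Tree → Carrier
  youngerWeights = foldr (λ t w → youngerWeight t * w) 1#

  -- Includes the weight of the elder leaf in front of the second child.
  secondChildWeight : List Tree → Carrier
  secondChildWeight []       = u₂ * v₂
  secondChildWeight (c ∷ cs) = u₃ * treeWeight (c ∷ cs)

  emptyIndicator : List Tree → Carrier
  emptyIndicator []      = 1#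
  emptyIndicator (_ ∷ _) = 0#

  -- From the third child on, a leaf is a younger leaf whatever the number of siblings.
  youngerChildren-weight : ∀ n i r →
    indicator (isTipAugF r) * kindProduct (childKinds (suc (suc n)) (suc (suc i)) r ++ leafKindsF r)
      ≈ youngerWeights r
  youngerChildren-weight n i []                  = *-identityˡ 1#
  youngerChildren-weight n i (node [] ∷ r)       = begin
    indicator (isTipAugF r) * (v₁ * kindProduct (ks ++ leafKindsF r))
      ≈⟨ solve 3 (λ a b p → a :* (b :* p) := b :* (a :* p)) refl _ _ _ ⟩
    v₁ * (indicator (isTipAugF r) * kindProduct (ks ++ leafKindsF r))
      ≈⟨ *-congˡ (youngerChildren-weight n (suc i) r) ⟩
    v₁ * youngerWeights r ∎
    where ks = childKinds (suc (suc n)) (suc (suc (suc i))) r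
  youngerChildren-weight n i (node (c ∷ cs) ∷ r) = begin
    indicator (isTipAug d ∧ isTipAugF r) * kindProduct (ks ++ (leafKinds d ++ leafKindsF r))
      ≈⟨ *-cong (indicator-∧ (isTipAug d) (isTipAugF r))
                (trans (kindProduct-++ ks _) (*-congˡ (kindProduct-++ (leafKinds d) _))) ⟩
    (indicator (isTipAug d) * indicator (isTipAugF r))
      * (kindProduct ks * (kindProduct (leafKinds d) * kindProduct (leafKindsF r)))
      ≈⟨ solve 5 (λ a b p q s → (a :* b) :* (p :* (q :* s)) := (a :* q) :* (b :* (p :* s)))
               refl _ _ _ _ _ ⟩
    treeWeight (c ∷ cs) * (indicator (isTipAugF r) * (kindProduct ks * kindProduct (leafKindsF r)))
      ≈⟨ *-congˡ (trans (*-congˡ (sym (kindProduct-++ ks _))) (youngerChildren-weight n (suc i) r)) ⟩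
    treeWeight (c ∷ cs) * youngerWeights r ∎
    where
    d = node (c ∷ cs)
    ks = childKinds (suc (suc n)) (suc (suc (suc i))) r

  treeWeight-firstChild : ∀ a r →
    treeWeight (node a ∷ r) ≈ emptyIndicator a * treeWeight (node [] ∷ r)
  treeWeight-firstChild []       r = sym (*-identityˡ _)
  treeWeight-firstChild (c ∷ cs) r = trans (zeroˡ _) (sym (zeroˡ _))

  treeWeight-singleLeaf : treeWeight (node [] ∷ []) ≈ u₁
  treeWeight-singleLeaf = trans (*-identityˡ _) (*-identityʳ u₁)

  treeWeight-secondChild : ∀ a r →
    treeWeight (node [] ∷ node a ∷ r) ≈ secondChildWeight a * youngerWeights r
  treeWeight-secondChild [] r = begin
    indicator (isTipAugF r) * (u₂ * (v₂ * kindProduct (ks ++ leafKindsF r)))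
      ≈⟨ solve 4 (λ a x y p → a :* (x :* (y :* p)) := (x :* y) :* (a :* p)) refl _ _ _ _ ⟩
    (u₂ * v₂) * (indicator (isTipAugF r) * kindProduct (ks ++ leafKindsF r))
      ≈⟨ *-congˡ (youngerChildren-weight (length r) 0 r) ⟩
    (u₂ * v₂) * youngerWeights r ∎
    where ks = childKinds (suc (suc (length r))) 2 r
  treeWeight-secondChild (c ∷ cs) r = begin
    indicator (isTipAug d ∧ isTipAugF r) * (u₃ * kindProduct (ks ++ (leafKinds d ++ leafKindsF r)))
      ≈⟨ *-cong (indicator-∧ (isTipAug d) (isTipAugF r))
                (*-congˡ (trans (kindProduct-++ ks _) (*-congˡ (kindProduct-++ (leafKinds d) _)))) ⟩
    (indicator (isTipAug d) * indicator (isTipAugF r))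
      * (u₃ * (kindProduct ks * (kindProduct (leafKinds d) * kindProduct (leafKindsF r))))
      ≈⟨ solve 6 (λ a b u p q s → (a :* b) :* (u :* (p :* (q :* s)))
                                  := (u :* (a :* q)) :* (b :* (p :* s)))
               refl _ _ _ _ _ _ ⟩
    (u₃ * treeWeight (c ∷ cs)) * (indicator (isTipAugF r) * (kindProduct ks * kindProduct (leafKindsF r)))
      ≈⟨ *-congˡ (trans (*-congˡ (sym (kindProduct-++ ks _))) (youngerChildren-weight (length r) 0 r)) ⟩
    (u₃ * treeWeight (c ∷ cs)) * youngerWeights r ∎
    where
    d = node (c ∷ cs)
    ks = childKinds (suc (suc (length r))) 2 r

module GeneratingSeries {c ℓ} (R : CommutativeRing c ℓ)
  (u₁ u₂ u₃ v₁ v₂ : CommutativeRing.Carrier R) where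
  open CommutativeRing R
  open Series R
  open FormalPowerSeries R
  open ListSums R
  open ForestSums R
  open LeafWeights R u₁ u₂ u₃ v₁ v₂
  open import Relation.Binary.Reasoning.Setoid setoid

  -- treeGF m is the total weight of the trees with m + 1 edges.
  youngerSiblingsGF youngerGF treeGF secondChildGF : Seriesₚ
  youngerSiblingsGF = forestSum youngerWeights
  youngerGF         = forestSum (youngerWeight ∘ node)
  treeGF            = tailₛ (forestSum treeWeight)
  secondChildGF     = forestSum secondChildWeight

  leafFirstGF : Seriesₚ
  leafFirstGF = forestSum (λ r → treeWeight (node [] ∷ r))

  forestSum-emptyIndicator : forestSum emptyIndicator ≋ 1ₛ
  forestSum-emptyIndicator zero    = forestSum-zero emptyIndicator
  forestSum-emptyIndicator (suc m) = trans (forestSum-tail-cong {g′ = λ _ → 0#} (λ _ _ → refl) m)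
                                (sumMap-zero (λ _ → refl) (forests (suc m)))

  treeGF≋leafFirstGF : treeGF ≋ leafFirstGF
  treeGF≋leafFirstGF m = begin
    treeGF m
      ≈⟨ forestSum-tail-* emptyIndicator (λ r → treeWeight (node [] ∷ r)) treeWeight-firstChild m ⟩
    (forestSum emptyIndicator *ₛ leafFirstGF) m
      ≈⟨ *ₛ-cong {g = leafFirstGF} {g′ = leafFirstGF} forestSum-emptyIndicator (λ _ → refl) m ⟩
    (1ₛ *ₛ leafFirstGF) m
      ≈⟨ *ₛ-identityˡ leafFirstGF m ⟩
    leafFirstGF m ∎

  treeGF-tail : tailₛ treeGF ≋ secondChildGF *ₛ youngerSiblingsGF
  treeGF-tail m = trans (treeGF≋leafFirstGF (suc m))
                        (forestSum-tail-* secondChildWeight youngerWeights treeWeight-secondChild m)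

  youngerSiblingsGF-equation :
    youngerSiblingsGF ≋ 1ₛ +ₛ (X *ₛ (youngerGF *ₛ youngerSiblingsGF))
  youngerSiblingsGF-equation = ≋-const+X*ₛ (forestSum-zero youngerWeights)
    (forestSum-tail-* (youngerWeight ∘ node) youngerWeights (λ _ _ → refl))

  youngerGF-equation : youngerGF ≋ constₛ v₁ +ₛ (X *ₛ treeGF)
  youngerGF-equation =
    ≋-const+X*ₛ (forestSum-zero (youngerWeight ∘ node)) (forestSum-tail-cong (λ _ _ → refl))

  treeGF-equation : treeGF ≋ constₛ u₁ +ₛ (X *ₛ (secondChildGF *ₛ youngerSiblingsGF))
  treeGF-equation = ≋-const+X*ₛ
    (trans (treeGF≋leafFirstGF 0)
           (trans (forestSum-zero (λ r → treeWeight (node [] ∷ r))) treeWeight-singleLeaf))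
    treeGF-tail

  secondChildGF-equation :
    secondChildGF ≋ constₛ (u₂ * v₂) +ₛ (X *ₛ (constₛ u₃ *ₛ treeGF))
  secondChildGF-equation = ≋-const+X*ₛ (forestSum-zero secondChildWeight)
    (λ m → begin
      secondChildGF (suc m)
        ≈⟨ forestSum-tail-cong {g′ = λ cs → u₃ * treeWeight cs} (λ _ _ → refl) m ⟩
      sumMap (λ cs → u₃ * treeWeight cs) (forests (suc m))
        ≈⟨ sumMap-*ˡ u₃ treeWeight (forests (suc m)) ⟩
      u₃ * treeGF m
        ≈⟨ *ₛ-constˡ u₃ treeGF m ⟨
      (constₛ u₃ *ₛ treeGF) m ∎)

  M-tail : tailₛ (M u₁ u₂ u₃ v₁ v₂) ≋ tailₛ treeGF
  M-tail n = begin
    sumMap (monomial u₁ u₂ u₃ v₁ v₂) (tipAugTrees (suc (suc n)))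
      ≈⟨ sumMap-filter isTipAug (monomial u₁ u₂ u₃ v₁ v₂) (map node (forests (suc (suc n)))) ⟩
    sumMap (λ t → indicator (isTipAug t) * monomial u₁ u₂ u₃ v₁ v₂ t)
           (map node (forests (suc (suc n))))
      ≡⟨ sumMap-map _ node (forests (suc (suc n))) ⟩
    treeGF (suc n) ∎

  M-equation :
    M u₁ u₂ u₃ v₁ v₂ ≋ constₛ u₃ +ₛ (X *ₛ (secondChildGF *ₛ youngerSiblingsGF))
  M-equation = ≋-const+X*ₛ refl (λ m → trans (M-tail m) (treeGF-tail m))

module DiscriminantAlgebra {c ℓ} (R : CommutativeRing c ℓ) where
  open CommutativeRing R
  open Series R using (two)
  open IntegerCoefficientRingSolver R using (solve; _:=_; _:+_; _:*_; _:-_; con)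

  S-poly : (X V₁ U₁ U₃ M : Carrier) → Carrier
  S-poly X V₁ U₁ U₃ M = ((1# - X * V₁) + X * (X * (U₃ - U₁))) - X * (X * (two * M))

  D-poly : (X V₁ U₁ U₃ B : Carrier) → Carrier
  D-poly X V₁ U₁ U₃ B =
    (((1# - X * (two * V₁))
      + X * (X * (V₁ * V₁ - two * (U₁ + U₃))))
      + X * (X * (X * (two * ((U₁ * V₁ + U₃ * V₁) - two * B)))))
      + X * (X * (X * (X * ((U₃ - U₁) * (U₃ - U₁)))))

  S-poly²-expansion : ∀ X Q V₁ U₁ U₃ B →
    S-poly X V₁ U₁ U₃ (U₃ + X * Q) * S-poly X V₁ U₁ U₃ (U₃ + X * Q)
      ≈ D-poly X V₁ U₁ U₃ B
        - two * two * (X * (X * X))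
          * (Q * (1# - X * (V₁ + X * (U₁ + X * Q))) - (B + X * (U₃ * (U₁ + X * Q))))
  S-poly²-expansion = solve 6 (λ X Q V₁ U₁ U₃ B →
    let 𝟏 = con (+ 1) ; 𝟐 = con (+ 2)
        S = ((𝟏 :- X :* V₁) :+ X :* (X :* (U₃ :- U₁))) :- X :* (X :* (𝟐 :* (U₃ :+ X :* Q)))
    in S :* S
       := ((((𝟏 :- X :* (𝟐 :* V₁)) :+ X :* (X :* (V₁ :* V₁ :- 𝟐 :* (U₁ :+ U₃))))
           :+ X :* (X :* (X :* (𝟐 :* ((U₁ :* V₁ :+ U₃ :* V₁) :- 𝟐 :* B)))))
           :+ X :* (X :* (X :* (X :* ((U₃ :- U₁) :* (U₃ :- U₁))))))
          :- 𝟐 :* 𝟐 :* (X :* (X :* X))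
             :* (Q :* (𝟏 :- X :* (V₁ :+ X :* (U₁ :+ X :* Q)))
                 :- (B :+ X :* (U₃ :* (U₁ :+ X :* Q)))))
    refl

  open import Relation.Binary.Reasoning.Setoid setoid

  Y≈1+XEY⇒Y[1-XE]≈1 : ∀ {X E Y} → Y ≈ 1# + X * (E * Y) → Y * (1# - X * E) ≈ 1#
  Y≈1+XEY⇒Y[1-XE]≈1 {X} {E} {Y} Y≈1+XEY = begin
    Y * (1# - X * E)
      ≈⟨ solve 3 (λ X E Y → Y :* (con (+ 1) :- X :* E) := Y :- X :* (E :* Y)) refl X E Y ⟩
    Y - X * (E * Y)
      ≈⟨ +-congʳ Y≈1+XEY ⟩
    1# + X * (E * Y) - X * (E * Y)
      ≈⟨ solve 2 (λ a b → b :+ a :- a := b) refl (X * (E * Y)) 1# ⟩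
    1# ∎

  S-poly-congʳ : ∀ X V₁ U₁ U₃ {M M′} → M ≈ M′ →
    S-poly X V₁ U₁ U₃ M ≈ S-poly X V₁ U₁ U₃ M′
  S-poly-congʳ X V₁ U₁ U₃ M≈M′ = +-congˡ (-‿cong (*-congˡ (*-congˡ (*-congˡ M≈M′))))

  S-poly²≈D-poly : ∀ {X Y E T H M V₁ U₁ U₃ B} →
    Y ≈ 1# + X * (E * Y) → E ≈ V₁ + X * T → T ≈ U₁ + X * (H * Y) →
    H ≈ B + X * (U₃ * T) → M ≈ U₃ + X * (H * Y) →
    S-poly X V₁ U₁ U₃ M * S-poly X V₁ U₁ U₃ M ≈ D-poly X V₁ U₁ U₃ B
  S-poly²≈D-poly {X} {Y} {E} {T} {H} {M} {V₁} {U₁} {U₃} {B} Y≈ E≈ T≈ H≈ M≈ = begin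
    S-poly X V₁ U₁ U₃ M * S-poly X V₁ U₁ U₃ M
      ≈⟨ *-cong (S-poly-congʳ X V₁ U₁ U₃ M≈) (S-poly-congʳ X V₁ U₁ U₃ M≈) ⟩
    S-poly X V₁ U₁ U₃ (U₃ + X * Q) * S-poly X V₁ U₁ U₃ (U₃ + X * Q)
      ≈⟨ S-poly²-expansion X Q V₁ U₁ U₃ B ⟩
    D-poly X V₁ U₁ U₃ B - two * two * (X * (X * X)) * P
      ≈⟨ +-congˡ (-‿cong (*-congˡ P≈0)) ⟩
    D-poly X V₁ U₁ U₃ B - two * two * (X * (X * X)) * 0#
      ≈⟨ solve 2 (λ d c → d :- c :* con (+ 0) := d) refl _ (two * two * (X * (X * X))) ⟩
    D-poly X V₁ U₁ U₃ B
      ∎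
    where
    Q = H * Y
    T′ = U₁ + X * Q
    P = Q * (1# - X * (V₁ + X * T′)) - (B + X * (U₃ * T′))
    Q[1-XE]≈H : Q * (1# - X * E) ≈ H
    Q[1-XE]≈H = begin
      H * Y * (1# - X * E)    ≈⟨ *-assoc H Y _ ⟩
      H * (Y * (1# - X * E))  ≈⟨ *-congˡ (Y≈1+XEY⇒Y[1-XE]≈1 Y≈) ⟩
      H * 1#                  ≈⟨ *-identityʳ H ⟩
      H                       ∎
    P≈0 : P ≈ 0#
    P≈0 = begin
      Q * (1# - X * (V₁ + X * T′)) - (B + X * (U₃ * T′))
        ≈⟨ +-cong (*-congˡ (+-congˡ (-‿cong (*-congˡ (trans E≈ (+-congˡ (*-congˡ T≈)))))))
                  (-‿cong (trans H≈ (+-congˡ (*-congˡ (*-congˡ T≈))))) ⟨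
      Q * (1# - X * E) - H
        ≈⟨ +-congʳ Q[1-XE]≈H ⟩
      H - H
        ≈⟨ -‿inverseʳ H ⟩
      0# ∎

module SquareRoot {c ℓ} (R : CommutativeRing c ℓ)
  (u₁ u₂ u₃ v₁ v₂ : CommutativeRing.Carrier R) where
  module R = CommutativeRing R
  open R using (_+_; _*_; -_; 1#)
  open Series R
  open FormalPowerSeries R
  open GeneratingSeries R u₁ u₂ u₃ v₁ v₂
  open CommutativeRing powerSeriesRing hiding (_+_; _*_; -_; 1#)
  open DiscriminantAlgebra powerSeriesRing using (S-poly; D-poly; S-poly²≈D-poly)

  V₁ U₁ U₃ B : Seriesₚ
  V₁ = constₛ v₁
  U₁ = constₛ u₁
  U₃ = constₛ u₃
  B  = constₛ (u₂ * v₂)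

  constₛ-two : constₛ two ≋ 1ₛ +ₛ 1ₛ
  constₛ-two = constₛ-+ 1# 1#

  constₛ-u₃-u₁ : constₛ (u₃ + - u₁) ≋ U₃ - U₁
  constₛ-u₃-u₁ = trans (constₛ-+ u₃ (- u₁)) (+-congˡ (constₛ-‿ u₁))

  S≋S-poly : S u₁ u₂ u₃ v₁ v₂ ≋ S-poly X V₁ U₁ U₃ (M u₁ u₂ u₃ v₁ v₂)
  S≋S-poly = +-cong (+-cong (+-congˡ (-‿cong (mono-≋ 1 refl))) (mono-≋ 2 constₛ-u₃-u₁))
                    (-‿cong (shift-≋ 2 two*M))
    where
    two*M : (λ n → two * M u₁ u₂ u₃ v₁ v₂ n) ≋ (1ₛ +ₛ 1ₛ) *ₛ M u₁ u₂ u₃ v₁ v₂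
    two*M = trans (sym (*ₛ-constˡ two _)) (*-congʳ constₛ-two)

  D≋D-poly : D u₁ u₂ u₃ v₁ v₂ ≋ D-poly X V₁ U₁ U₃ B
  D≋D-poly = +-cong (+-cong (+-cong (+-congˡ (-‿cong (mono-≋ 1 c₁))) (mono-≋ 2 c₂))
                            (mono-≋ 3 c₃))
                    (mono-≋ 4 c₄)
    where
    c₁ = trans (constₛ-* two v₁) (*-congʳ constₛ-two)
    c₂ = trans (constₛ-+ _ _) (+-cong (constₛ-* v₁ v₁)
           (trans (constₛ-‿ _)
                  (-‿cong (trans (constₛ-* _ _) (*-cong constₛ-two (constₛ-+ u₁ u₃))))))
    c₃ = trans (constₛ-* _ _) (*-cong constₛ-two (trans (constₛ-+ _ _)
           (+-cong (trans (constₛ-+ _ _) (+-cong (constₛ-* u₁ v₁) (constₛ-* u₃ v₁)))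
                   (trans (constₛ-‿ _) (-‿cong (trans (constₛ-* two _) (*-congʳ constₛ-two)))))))
    c₄ = trans (constₛ-* _ _) (*-cong constₛ-u₃-u₁ constₛ-u₃-u₁)

  S-constantTerm : S u₁ u₂ u₃ v₁ v₂ 0 R.≈ 1#
  S-constantTerm = solve 0 (((con (+ 1) :- con (+ 0)) :+ con (+ 0)) :- con (+ 0) := con (+ 1)) R.refl
    where open IntegerCoefficientRingSolver R using (solve; _:=_; _:+_; _:-_; con)

  S*S≋D : S u₁ u₂ u₃ v₁ v₂ *ₛ S u₁ u₂ u₃ v₁ v₂ ≋ D u₁ u₂ u₃ v₁ v₂
  S*S≋D = begin
    S u₁ u₂ u₃ v₁ v₂ *ₛ S u₁ u₂ u₃ v₁ v₂
      ≈⟨ *-cong S≋S-poly S≋S-poly ⟩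
    S-poly X V₁ U₁ U₃ M′ *ₛ S-poly X V₁ U₁ U₃ M′
      ≈⟨ S-poly²≈D-poly youngerSiblingsGF-equation youngerGF-equation treeGF-equation
                        secondChildGF-equation M-equation ⟩
    D-poly X V₁ U₁ U₃ B
      ≈⟨ D≋D-poly ⟨
    D u₁ u₂ u₃ v₁ v₂ ∎
    where
    open import Relation.Binary.Reasoning.Setoid setoid
    M′ = M u₁ u₂ u₃ v₁ v₂

theorem1p17 : {c ℓ : Level} (R : CommutativeRing c ℓ)
    (u₁ u₂ u₃ v₁ v₂ : CommutativeRing.Carrier R) →
    CommutativeRing._≈_ R (Series.S R u₁ u₂ u₃ v₁ v₂ 0) (CommutativeRing.1# R)
    × ((n : ℕ) → CommutativeRing._≈_ R
         (Series._*ₛ_ R (Series.S R u₁ u₂ u₃ v₁ v₂) (Series.S R u₁ u₂ u₃ v₁ v₂) n)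
         (Series.D R u₁ u₂ u₃ v₁ v₂ n))
theorem1p17 R u₁ u₂ u₃ v₁ v₂ = S-constantTerm , S*S≋D
  where open SquareRoot R u₁ u₂ u₃ v₁ v₂
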